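{- Let $\ell,e\ge1$ and let $\ell'=\ell-(\ell\bmod e)$. There is a Boolean circuit with $\ell$ inputs and $2e+1$ outputs such that, on input an $\ell$-bit number $u$, its first $e$ outputs give (in binary) an integer in $\{0,\dots,2^e-1\}$ congruent to $u$ modulo $2^e-1$, and its last $e+1$ outputs give (in binary) $u\bmod(2^e+1)$. The circuit consists of $2\ell+2e$ gates of fan-in 3 and $4e+2\ell'$ gates of fan-in 2.
   Context: An $\ell$-bit number is an integer in $\{0,\dots,2^\ell-1\}$ given by its binary digits. Gates of the circuit compute arbitrary Boolean functions of their (two or three) inputs. -}

module Defs where

open import Data.Nat using (ℕ; zero; suc; _+_; _*_)
open import Data.Bool using (Bool; true; false)
open import Data.Fin using (Fin)
open import Data.Vec using (Vec; []; _∷_; _∷ʳ_; lookup; map)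

bit : Bool → ℕ
bit false = 0
bit true  = 1

-- Binary value of a bit vector, little-endian: the i-th entry has weight 2^i.
val : ∀ {n} → Vec Bool n → ℕ
val []       = 0
val (b ∷ bs) = bit b + 2 * val bs

data Gate (k : ℕ) : Set where
  gate2 : (Bool → Bool → Bool) → Fin k → Fin k → Gate k
  gate3 : (Bool → Bool → Bool → Bool) → Fin k → Fin k → Fin k → Gate k

-- Wires are numbered
-- 0 .. n-1 (inputs) followed by the gates in order; the gate added at
-- step j (0-based) may read any of the n + j earlier wires.
data Gates (n : ℕ) : ℕ → Set where
  []  : Gates n 0
  _▷_ : ∀ {g} → Gates n g → Gate (g + n) → Gates n (suc g)

wires : ∀ {n g} → Gates n g → Vec Bool n → Vec Bool (g + n)
wires []         x = x
wires (C ▷ gate2 f a b)   x = let w = wires C x in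
  w ∷ʳ f (lookup w a) (lookup w b)
wires (C ▷ gate3 f a b c) x = let w = wires C x in
  w ∷ʳ f (lookup w a) (lookup w b) (lookup w c)

count2 : ∀ {n g} → Gates n g → ℕ
count2 []               = 0
count2 (C ▷ gate2 _ _ _)   = suc (count2 C)
count2 (C ▷ gate3 _ _ _ _) = count2 C

count3 : ∀ {n g} → Gates n g → ℕ
count3 []               = 0
count3 (C ▷ gate2 _ _ _)   = count3 C
count3 (C ▷ gate3 _ _ _ _) = suc (count3 C)

record Circuit (n m : ℕ) : Set where
  field
    size    : ℕ
    gates   : Gates n size
    outputs : Vec (Fin (size + n)) m

open Circuit public

run : ∀ {n m} → Circuit n m → Vec Bool n → Vec Bool m
run C x = map (lookup (wires (gates C) x)) (outputs C)

module Submission where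

-- With W = 2e we have 2^W − 1 = (2^e − 1)(2^e + 1), so it suffices to reduce u modulo 2^W − 1 to a
-- W-bit number R = L + 2^e H, and then R to L + H modulo 2^e − 1 and to L − H modulo 2^e + 1.
-- Since 2^W ≡ 1, the first reduction adds up the W-bit blocks of u with ripple-carry adders whose
-- carry-out is fed back as the carry-in of the next block (end-around carry); the last, partial block
-- and the final carry are absorbed by two incrementers and one extra gate.  L + H is again an
-- end-around sum, and L − H is computed as L + ¬H + 1, corrected by the complemented carry.
-- A full adder costs two fan-in-3 gates and a half adder two fan-in-2 gates; inputs shorter than 2e
-- skip the first reduction, and the unused budget is filled with constant gates.

open import Defs
open import Data.Nat using (ℕ; zero; suc; _+_; _*_; _∸_; _^_; _≤_; _<_; z≤n; s≤s; _%_; _/_; NonZero; _<?_; _≤?_)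
open import Data.Nat.Properties
open import Data.Nat.DivMod using ([m+kn]%n≡m%n; m<n⇒m%n≡m; m%n<n; m≡m%n+[m/n]*n; m*n/n≡m; /-monoˡ-≤)
open import Data.Nat.Tactic.RingSolver using (solve-∀)
open import Data.Bool using (Bool; true; false; not; _xor_; _∧_; _∨_)
open import Data.Fin using (Fin; zero; suc; inject₁; fromℕ; _↑ʳ_)
open import Data.Vec using (Vec; []; _∷_; _∷ʳ_; _++_; lookup; map; replicate; padRight; head; tail; splitAt; take; drop; allFin; tabulate)
open import Data.Vec.Properties using (map-∘; map-++; map-cong; ++-injective; take++drop≡id; tabulate-∘; tabulate∘lookup)
open import Data.Product using (Σ; Σ-syntax; ∃-syntax; _×_; _,_; proj₁; proj₂; map₂)
open import Data.Empty using (⊥-elim)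
open import Data.Integer using (+_; _-_; _⊖_; ∣_∣)
open import Data.Integer.Divisibility using (_∣_; divides)
import Data.Integer.Properties as ℤ
open import Function using (id; const; _∘_)
open import Relation.Binary.PropositionalEquality
open import Relation.Nullary using (yes; no)

carry₃ : Bool → Bool → Bool → Bool
carry₃ a b c = (a ∧ b) ∨ (c ∧ (a xor b))

bit-xor-carry₃ : ∀ a b c → bit (a xor b xor c) + 2 * bit (carry₃ a b c) ≡ bit a + bit b + bit c
bit-xor-carry₃ false false false = refl
bit-xor-carry₃ false false true  = refl
bit-xor-carry₃ false true  false = refl
bit-xor-carry₃ false true  true  = refl
bit-xor-carry₃ true  false false = refl
bit-xor-carry₃ true  false true  = refl
bit-xor-carry₃ true  true  false = refl
bit-xor-carry₃ true  true  true  = refl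

bit-xor-∧ : ∀ a b → bit (a xor b) + 2 * bit (a ∧ b) ≡ bit a + bit b
bit-xor-∧ false false = refl
bit-xor-∧ false true  = refl
bit-xor-∧ true  false = refl
bit-xor-∧ true  true  = refl

bit-not+bit : ∀ b → bit (not b) + bit b ≡ 1
bit-not+bit false = refl
bit-not+bit true  = refl

bit≤1 : ∀ b → bit b ≤ 1
bit≤1 false = z≤n
bit≤1 true  = s≤s z≤n

bit-head≡0 : ∀ b h → bit b + 2 * h ≡ 0 → b ≡ false
bit-head≡0 false h _ = refl

bit-xor-absorbs : ∀ b c h → (c ≡ true → b ≡ false) → bit (b xor c) + 2 * h ≡ (bit b + 2 * h) + bit c
bit-xor-absorbs false false h _ = sym (+-identityʳ (2 * h))
bit-xor-absorbs false true  h _ = +-comm 1 (2 * h)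
bit-xor-absorbs true  false h _ = sym (+-identityʳ (1 + 2 * h))
bit-xor-absorbs true  true  h c⇒¬b with c⇒¬b refl
... | ()

lookup-∷ʳ-inject₁ : ∀ {A : Set} {m} (xs : Vec A m) y i → lookup (xs ∷ʳ y) (inject₁ i) ≡ lookup xs i
lookup-∷ʳ-inject₁ (x ∷ xs) y zero    = refl
lookup-∷ʳ-inject₁ (x ∷ xs) y (suc i) = lookup-∷ʳ-inject₁ xs y i

lookup-∷ʳ-fromℕ : ∀ {A : Set} {m} (xs : Vec A m) y → lookup (xs ∷ʳ y) (fromℕ m) ≡ y
lookup-∷ʳ-fromℕ []       y = refl
lookup-∷ʳ-fromℕ (x ∷ xs) y = lookup-∷ʳ-fromℕ xs y

take-drop-++ : ∀ {A : Set} {m k} (v : Vec A (m + k)) (ys : Vec A m) (zs : Vec A k) →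
               v ≡ ys ++ zs → take m v ≡ ys × drop m v ≡ zs
take-drop-++ {m = m} v ys zs v≡ = ++-injective (take m v) ys (trans (take++drop≡id m v) v≡)

val-++ : ∀ {m k} (xs : Vec Bool m) (ys : Vec Bool k) → val (xs ++ ys) ≡ val xs + 2 ^ m * val ys
val-++ []       ys = sym (+-identityʳ _)
val-++ {suc m} (b ∷ xs) ys = begin
  bit b + 2 * val (xs ++ ys)               ≡⟨ cong (λ v → bit b + 2 * v) (val-++ xs ys) ⟩
  bit b + 2 * (val xs + 2 ^ m * val ys)    ≡⟨ regroup (bit b) (val xs) (2 ^ m) (val ys) ⟩
  bit b + 2 * val xs + 2 * 2 ^ m * val ys  ∎
  where
  open ≡-Reasoning
  regroup : ∀ a v p y → a + 2 * (v + p * y) ≡ a + 2 * v + 2 * p * y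
  regroup = solve-∀

val<2^ : ∀ {m} (xs : Vec Bool m) → val xs < 2 ^ m
val<2^ []               = s≤s z≤n
val<2^ {suc m} (b ∷ xs) = begin
  suc (bit b + 2 * val xs)  ≤⟨ s≤s (+-monoˡ-≤ (2 * val xs) (bit≤1 b)) ⟩
  2 + 2 * val xs            ≡⟨ *-distribˡ-+ 2 1 (val xs) ⟨
  2 * suc (val xs)          ≤⟨ *-monoʳ-≤ 2 (val<2^ xs) ⟩
  2 * 2 ^ m                 ∎
  where open ≤-Reasoning

val-map-not : ∀ {m} (xs : Vec Bool m) → val (map not xs) + val xs + 1 ≡ 2 ^ m
val-map-not []               = refl
val-map-not {suc m} (b ∷ xs) = begin
  bit (not b) + 2 * val (map not xs) + (bit b + 2 * val xs) + 1
    ≡⟨ regroup (bit (not b)) (bit b) (val (map not xs)) (val xs) ⟩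
  (bit (not b) + bit b) + 1 + 2 * (val (map not xs) + val xs)
    ≡⟨ cong (λ t → t + 1 + 2 * (val (map not xs) + val xs)) (bit-not+bit b) ⟩
  1 + 1 + 2 * (val (map not xs) + val xs)
    ≡⟨ double-suc (val (map not xs) + val xs) ⟩
  2 * (val (map not xs) + val xs + 1)
    ≡⟨ cong (2 *_) (val-map-not xs) ⟩
  2 * 2 ^ m ∎
  where
  open ≡-Reasoning
  regroup : ∀ nb b u v → nb + 2 * u + (b + 2 * v) + 1 ≡ (nb + b) + 1 + 2 * (u + v)
  regroup = solve-∀
  double-suc : ∀ w → 1 + 1 + 2 * w ≡ 2 * (w + 1)
  double-suc = solve-∀

val-map-replicate : ∀ {A : Set} (f : A → Bool) {z : A} → f z ≡ false →
                    ∀ k → val (map f (replicate k z)) ≡ 0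
val-map-replicate f fz zero    = refl
val-map-replicate f fz (suc k) = cong₂ (λ b v → bit b + 2 * v) fz (val-map-replicate f fz k)

val-map-padRight : ∀ {A : Set} {m k} (f : A → Bool) {z : A} → f z ≡ false →
                   (m≤k : m ≤ k) (xs : Vec A m) → val (map f (padRight m≤k z xs)) ≡ val (map f xs)
val-map-padRight {k = k} f fz z≤n [] = val-map-replicate f fz k
val-map-padRight f fz (s≤s m≤k) (x ∷ xs) = cong (λ v → bit (f x) + 2 * v) (val-map-padRight f fz m≤k xs)

infix 4 _≋_mod_
record _≋_mod_ (x y m : ℕ) : Set where
  constructor ⟨_,_⟩
  field
    quotient : ℕ
    equation : x ≡ y + m * quotient

≋-refl : ∀ {x m} → x ≋ x mod m
≋-refl {x} {m} = ⟨ 0 , sym (trans (cong (λ t → x + t) (*-zeroʳ m)) (+-identityʳ x)) ⟩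

≡⇒≋ : ∀ {x y m} → x ≡ y → x ≋ y mod m
≡⇒≋ refl = ≋-refl

≋-trans : ∀ {x y z m} → x ≋ y mod m → y ≋ z mod m → x ≋ z mod m
≋-trans {z = z} {m} ⟨ q , x≡ ⟩ ⟨ q′ , y≡ ⟩ = ⟨ q′ + q , (begin
  _                        ≡⟨ x≡ ⟩
  _ + m * q                ≡⟨ cong (_+ m * q) y≡ ⟩
  z + m * q′ + m * q       ≡⟨ +-assoc z (m * q′) (m * q) ⟩
  z + (m * q′ + m * q)     ≡⟨ cong (λ t → z + t) (*-distribˡ-+ m q′ q) ⟨
  z + m * (q′ + q)         ∎) ⟩
  where open ≡-Reasoning

≋-resp : ∀ {x x′ y y′ m} → x ≡ x′ → y ≡ y′ → x ≋ y mod m → x′ ≋ y′ mod m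
≋-resp refl refl x≋y = x≋y

≋-mod-*ʳ : ∀ {x y} a b → x ≋ y mod (a * b) → x ≋ y mod a
≋-mod-*ʳ {y = y} a b ⟨ q , x≡ ⟩ = ⟨ b * q , trans x≡ (cong (λ t → y + t) (*-assoc a b q)) ⟩

≋-mod-*ˡ : ∀ {x y} a b → x ≋ y mod (a * b) → x ≋ y mod b
≋-mod-*ˡ {x} {y} a b x≋y = ≋-mod-*ʳ b a (subst (λ m → x ≋ y mod m) (*-comm a b) x≋y)

≋⇒∣ : ∀ {x y m} → x ≋ y mod m → (+ m) ∣ (+ y - + x)
≋⇒∣ {y = y} {m} ⟨ q , refl ⟩ = divides q (begin
  ∣ + y - + (y + m * q) ∣  ≡⟨ cong ∣_∣ (ℤ.m-n≡m⊖n y (y + m * q)) ⟩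
  ∣ y ⊖ (y + m * q) ∣      ≡⟨ ℤ.∣m⊖n∣≡∣n⊖m∣ y (y + m * q) ⟩
  ∣ (y + m * q) ⊖ y ∣      ≡⟨ cong ∣_∣ (ℤ.⊖-≥ (m≤m+n y (m * q))) ⟩
  y + m * q ∸ y                          ≡⟨ m+n∸m≡n y (m * q) ⟩
  m * q                                  ≡⟨ *-comm m q ⟩
  q * m                                  ∎)
  where open ≡-Reasoning

≋⇒%≡ : ∀ {x y m} .{{_ : NonZero m}} → y < m → x ≋ y mod m → x % m ≡ y
≋⇒%≡ {y = y} {m} y<m ⟨ q , refl ⟩ = begin
  (y + m * q) % m  ≡⟨ cong (λ t → (y + t) % m) (*-comm m q) ⟩
  (y + q * m) % m  ≡⟨ [m+kn]%n≡m%n y q m ⟩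
  y % m            ≡⟨ m<n⇒m%n≡m y<m ⟩
  y                ∎
  where open ≡-Reasoning

ripple-step : ∀ {s v p co A c₁ a c} → v + p * co ≡ A + c₁ → s + 2 * c₁ ≡ a + c →
              s + 2 * v + 2 * p * co ≡ (a + 2 * A) + c
ripple-step {s} {v} {p} {co} {A} {c₁} {a} {c} high low = begin
  s + 2 * v + 2 * p * co  ≡⟨ factor s v p co ⟩
  s + 2 * (v + p * co)    ≡⟨ cong (λ t → s + 2 * t) high ⟩
  s + 2 * (A + c₁)        ≡⟨ expand s A c₁ ⟩
  (s + 2 * c₁) + 2 * A    ≡⟨ cong (_+ 2 * A) low ⟩
  (a + c) + 2 * A         ≡⟨ swap a c (2 * A) ⟩
  (a + 2 * A) + c         ∎
  where
  open ≡-Reasoning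
  factor : ∀ s v p co → s + 2 * v + 2 * p * co ≡ s + 2 * (v + p * co)
  factor = solve-∀
  expand : ∀ s A c₁ → s + 2 * (A + c₁) ≡ (s + 2 * c₁) + 2 * A
  expand = solve-∀
  swap : ∀ a c d → (a + c) + d ≡ (a + d) + c
  swap = solve-∀

overflow⇒carry-in : ∀ {a u s} cᵢ → a < u → s + u * 1 ≡ a + bit cᵢ → cᵢ ≡ true × s ≡ 0
overflow⇒carry-in {a} {u} {s} false a<u eq = ⊥-elim (<⇒≱ a<u (begin
  u          ≤⟨ m≤n+m u s ⟩
  s + u      ≡⟨ cong (λ t → s + t) (*-identityʳ u) ⟨
  s + u * 1  ≡⟨ eq ⟩
  a + 0      ≡⟨ +-identityʳ a ⟩
  a          ∎))
  where open ≤-Reasoning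
overflow⇒carry-in {a} {u} {s} true a<u eq = refl , n≤0⇒n≡0 (+-cancelʳ-≤ u s 0 (begin
  s + u      ≡⟨ cong (λ t → s + t) (*-identityʳ u) ⟨
  s + u * 1  ≡⟨ eq ⟩
  a + 1      ≡⟨ +-comm a 1 ⟩
  suc a      ≤⟨ a<u ⟩
  u          ∎))
  where open ≤-Reasoning

overflow-twice⇒zero : ∀ {Lo₁ Lo₂ Hi Hi₁ t u} c₁ c₂ c₃ → Lo₁ < t → Hi < u →
                      Hi₁ + u * bit c₂ ≡ Hi + bit c₁ → Lo₂ + t * bit c₃ ≡ Lo₁ + bit c₂ →
                      c₃ ≡ true → Hi₁ ≡ 0
overflow-twice⇒zero c₁ c₂ true Lo₁<t Hi<u high low refl with overflow⇒carry-in c₂ Lo₁<t low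
... | refl , _ = proj₂ (overflow⇒carry-in c₁ Hi<u high)

end-around-block : ∀ {acc blk c rest s co M} → s + suc M * co ≡ acc + blk + c →
                   acc + c + suc M * (blk + suc M * rest) ≋ s + co + suc M * rest mod M
end-around-block {acc} {blk} {c} {rest} {s} {co} {M} sum≡ = ⟨ co + blk + suc M * rest , (begin
  acc + c + suc M * (blk + suc M * rest)
    ≡⟨ split acc blk c rest M ⟩
  (acc + blk + c) + M * blk + suc M * (suc M * rest)
    ≡⟨ cong (λ t → t + M * blk + suc M * (suc M * rest)) sum≡ ⟨
  (s + suc M * co) + M * blk + suc M * (suc M * rest)
    ≡⟨ merge s co blk rest M ⟩
  s + co + suc M * rest + M * (co + blk + suc M * rest) ∎) ⟩
  where
  open ≡-Reasoning
  split : ∀ acc blk c rest M →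
          acc + c + suc M * (blk + suc M * rest) ≡ (acc + blk + c) + M * blk + suc M * (suc M * rest)
  split = solve-∀
  merge : ∀ s co blk rest M → (s + suc M * co) + M * blk + suc M * (suc M * rest)
                               ≡ s + co + suc M * rest + M * (co + blk + suc M * rest)
  merge = solve-∀

-- The partial block Y is added into the low bits and the carry propagated through the high bits; the
-- carry c₂ out of the top re-enters at the bottom because t · u ≡ 1 (mod M).
fold-remainder : ∀ {Lo Hi Y c Lo₁ c₁ Hi₁ c₂ Lo₂ c₃ t u M} → t * u ≡ suc M →
                 Lo₁ + t * c₁ ≡ Lo + Y + c → Hi₁ + u * c₂ ≡ Hi + c₁ → Lo₂ + t * c₃ ≡ Lo₁ + c₂ →
                 Lo + t * Hi + c + suc M * Y ≋ Lo₂ + t * (Hi₁ + c₃) mod M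
fold-remainder {Lo} {Hi} {Y} {c} {Lo₁} {c₁} {Hi₁} {c₂} {Lo₂} {c₃} {t} {u} {M} tu≡ low high low′ =
  ⟨ Y + c₂ , (begin
  Lo + t * Hi + c + suc M * Y              ≡⟨ step₁ Lo Hi Y c t M ⟩
  (Lo + Y + c) + t * Hi + M * Y            ≡⟨ cong (λ z → z + t * Hi + M * Y) low ⟨
  (Lo₁ + t * c₁) + t * Hi + M * Y          ≡⟨ step₂ Lo₁ c₁ Hi t M Y ⟩
  Lo₁ + t * (Hi + c₁) + M * Y              ≡⟨ cong (λ z → Lo₁ + t * z + M * Y) high ⟨
  Lo₁ + t * (Hi₁ + u * c₂) + M * Y         ≡⟨ step₃ Lo₁ Hi₁ c₂ t u M Y ⟩
  Lo₁ + t * Hi₁ + (t * u) * c₂ + M * Y     ≡⟨ cong (λ z → Lo₁ + t * Hi₁ + z * c₂ + M * Y) tu≡ ⟩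
  Lo₁ + t * Hi₁ + suc M * c₂ + M * Y       ≡⟨ step₄ Lo₁ Hi₁ c₂ t M Y ⟩
  (Lo₁ + c₂) + t * Hi₁ + M * (Y + c₂)      ≡⟨ cong (λ z → z + t * Hi₁ + M * (Y + c₂)) low′ ⟨
  (Lo₂ + t * c₃) + t * Hi₁ + M * (Y + c₂)  ≡⟨ step₅ Lo₂ c₃ Hi₁ t M (Y + c₂) ⟩
  Lo₂ + t * (Hi₁ + c₃) + M * (Y + c₂)      ∎) ⟩
  where
  open ≡-Reasoning
  step₁ : ∀ Lo Hi Y c t M → Lo + t * Hi + c + suc M * Y ≡ (Lo + Y + c) + t * Hi + M * Y
  step₁ = solve-∀
  step₂ : ∀ Lo₁ c₁ Hi t M Y → (Lo₁ + t * c₁) + t * Hi + M * Y ≡ Lo₁ + t * (Hi + c₁) + M * Y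
  step₂ = solve-∀
  step₃ : ∀ Lo₁ Hi₁ c₂ t u M Y → Lo₁ + t * (Hi₁ + u * c₂) + M * Y ≡ Lo₁ + t * Hi₁ + (t * u) * c₂ + M * Y
  step₃ = solve-∀
  step₄ : ∀ Lo₁ Hi₁ c₂ t M Y → Lo₁ + t * Hi₁ + suc M * c₂ + M * Y ≡ (Lo₁ + c₂) + t * Hi₁ + M * (Y + c₂)
  step₄ = solve-∀
  step₅ : ∀ Lo₂ c₃ Hi₁ t M Z → (Lo₂ + t * c₃) + t * Hi₁ + M * Z ≡ Lo₂ + t * (Hi₁ + c₃) + M * Z
  step₅ = solve-∀

end-around-no-overflow : ∀ {a L H S O} c₁ c₂ → L < suc a → H < suc a → S < suc a →
                         S + suc a * bit c₁ ≡ L + H + 0 → O + suc a * bit c₂ ≡ S + bit c₁ → c₂ ≡ false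
end-around-no-overflow c₁ false L<t H<t S<t sum≡ inc≡ = refl
end-around-no-overflow {a} {L} {H} {S} c₁ true L<t H<t S<t sum≡ inc≡
  with overflow⇒carry-in c₁ S<t inc≡
... | refl , refl = ⊥-elim (<⇒≱ (begin-strict
  a + a              <⟨ +-monoʳ-< a (n<1+n a) ⟩
  a + suc a          ≡⟨ cong₂ _+_ S≡a (*-identityʳ (suc a)) ⟨
  S + suc a * 1      ≡⟨ sum≡ ⟩
  L + H + 0          ≡⟨ +-identityʳ (L + H) ⟩
  L + H              ∎) (+-mono-≤ (≤-pred L<t) (≤-pred H<t)))
  where
  open ≤-Reasoning
  S≡a : S ≡ a
  S≡a = +-cancelʳ-≡ 1 S a (trans (sym inc≡) (trans (*-identityʳ (suc a)) (+-comm 1 a)))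

end-around-sum : ∀ {a L H S O} c₁ c₂ → L < suc a → H < suc a → S < suc a →
                 S + suc a * bit c₁ ≡ L + H + 0 → O + suc a * bit c₂ ≡ S + bit c₁ →
                 L + suc a * H ≋ O mod a
end-around-sum {a} {L} {H} {S} {O} c₁ c₂ L<t H<t S<t sum≡ inc≡
  with end-around-no-overflow {O = O} c₁ c₂ L<t H<t S<t sum≡ inc≡
... | refl = ⟨ bit c₁ + H , (begin
  L + suc a * H                  ≡⟨ split L H a ⟩
  (L + H + 0) + a * H            ≡⟨ cong (_+ a * H) sum≡ ⟨
  (S + suc a * bit c₁) + a * H   ≡⟨ merge S (bit c₁) a H ⟩
  (S + bit c₁) + a * (bit c₁ + H) ≡⟨ cong (_+ a * (bit c₁ + H)) inc≡ ⟨
  (O + suc a * 0) + a * (bit c₁ + H) ≡⟨ cong (_+ a * (bit c₁ + H)) (vanish O a) ⟩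
  O + a * (bit c₁ + H)           ∎) ⟩
  where
  open ≡-Reasoning
  split : ∀ L H a → L + suc a * H ≡ (L + H + 0) + a * H
  split = solve-∀
  merge : ∀ S c a H → (S + suc a * c) + a * H ≡ (S + c) + a * (c + H)
  merge = solve-∀
  vanish : ∀ O a → O + suc a * 0 ≡ O
  vanish = solve-∀

-- With H̄ the complement of H, T + E · b = L − H + E: the carry b is set iff L ≥ H, and otherwise
-- adding 1 turns L − H + E into L − H + (E + 1).
difference-mod-suc : ∀ {E L H H̄ T} b → T < E → H̄ + H + 1 ≡ E → T + E * bit b ≡ L + H̄ + 1 →
                     T + bit (not b) < suc E × L + E * H ≋ T + bit (not b) mod suc E
difference-mod-suc {L = L} {H} {H̄} {T} true T<E refl sum≡ =
  m≤n⇒m≤1+n (subst (_< _) (sym (+-identityʳ T)) T<E) , ⟨ H , (begin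
  L + (H̄ + H + 1) * H          ≡⟨ cong (_+ (H̄ + H + 1) * H) L≡T+H ⟩
  T + H + (H̄ + H + 1) * H      ≡⟨ regroup T H (H̄ + H + 1) ⟩
  T + 0 + suc (H̄ + H + 1) * H  ∎) ⟩
  where
  open ≡-Reasoning
  regroup : ∀ T H E → T + H + E * H ≡ T + 0 + suc E * H
  regroup = solve-∀
  shift : ∀ T H H̄ → T + H + (H̄ + 1) ≡ T + (H̄ + H + 1) * 1
  shift = solve-∀
  L≡T+H : L ≡ T + H
  L≡T+H = +-cancelʳ-≡ (H̄ + 1) L (T + H) (sym (begin
    T + H + (H̄ + 1)          ≡⟨ shift T H H̄ ⟩
    T + (H̄ + H + 1) * 1      ≡⟨ sum≡ ⟩
    L + H̄ + 1                ≡⟨ +-assoc L H̄ 1 ⟩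
    L + (H̄ + 1)              ∎))
difference-mod-suc {L = L} {zero} {H̄} {T} false T<E refl sum≡ = ⊥-elim (<⇒≱ T<E (begin
  H̄ + 0 + 1                   ≤⟨ +-monoˡ-≤ 1 (+-monoˡ-≤ 0 (m≤n+m H̄ L)) ⟩
  L + H̄ + 0 + 1               ≡⟨ cong (_+ 1) (+-identityʳ (L + H̄)) ⟩
  L + H̄ + 1                   ≡⟨ sum≡ ⟨
  T + (H̄ + 0 + 1) * 0         ≡⟨ cong (λ t → T + t) (*-zeroʳ (H̄ + 0 + 1)) ⟩
  T + 0                       ≡⟨ +-identityʳ T ⟩
  T                           ∎))
  where open ≤-Reasoning
difference-mod-suc {L = L} {suc H} {H̄} {T} false T<E refl sum≡ =
  s≤s (subst (_≤ H̄ + suc H + 1) (+-comm 1 T) T<E) , ⟨ H , (begin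
  L + E * suc H                  ≡⟨ regroup L H̄ H ⟩
  L + H̄ + 1 + 1 + suc E * H      ≡⟨ cong (λ t → t + 1 + suc E * H) sum≡ ⟨
  T + E * 0 + 1 + suc E * H      ≡⟨ cong (λ t → t + 1 + suc E * H) (trans (cong (λ t → T + t) (*-zeroʳ E))
                                                                      (+-identityʳ T)) ⟩
  T + 1 + suc E * H              ∎) ⟩
  where
  open ≡-Reasoning
  E : ℕ
  E = H̄ + suc H + 1
  regroup : ∀ L H̄ H → L + (H̄ + suc H + 1) * suc H ≡ L + H̄ + 1 + 1 + suc (H̄ + suc H + 1) * H
  regroup = solve-∀

m*n≤o⇒m*n≤o∸o%n : ∀ m n o .{{_ : NonZero n}} → m * n ≤ o → m * n ≤ o ∸ o % n
m*n≤o⇒m*n≤o∸o%n m n o m*n≤o = begin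
  m * n                  ≤⟨ *-monoˡ-≤ n (subst (_≤ o / n) (m*n/n≡m m n) (/-monoˡ-≤ n m*n≤o)) ⟩
  o / n * n              ≡⟨ m+n∸m≡n (o % n) (o / n * n) ⟨
  o % n + o / n * n ∸ o % n ≡⟨ cong (_∸ o % n) (m≡m%n+[m/n]*n o n) ⟨
  o ∸ o % n              ∎
  where open ≤-Reasoning

long-budget₂ : ∀ e n .{{_ : NonZero e}} → e + e ≤ n → (e + e) * 2 + (e * 2 + e * 2) ≤ 4 * e + 2 * (n ∸ n % e)
long-budget₂ e n 2e≤n = begin
  (e + e) * 2 + (e * 2 + e * 2)  ≡⟨ regroup e ⟩
  4 * e + 2 * (2 * e)            ≤⟨ +-monoʳ-≤ (4 * e) (*-monoʳ-≤ 2 (m*n≤o⇒m*n≤o∸o%n 2 e n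
                                       (subst (_≤ n) (cong (λ t → e + t) (sym (+-identityʳ e))) 2e≤n))) ⟩
  4 * e + 2 * (n ∸ n % e)        ∎
  where
  open ≤-Reasoning
  regroup : ∀ e → (e + e) * 2 + (e * 2 + e * 2) ≡ 4 * e + 2 * (2 * e)
  regroup = solve-∀

long-budget₃ : ∀ B r e′ → B * ((suc e′ + suc e′) * 2) + (r * 2 + 1) + (suc e′ * 2 + suc e′ * 2)
                         ≤ 2 * ((suc e′ + suc e′) + (B * (suc e′ + suc e′) + r)) + 2 * suc e′
long-budget₃ B r e′ = ≤-trans (m≤m+n _ (2 * e′ + 1)) (≤-reflexive (regroup B r e′))
  where
  regroup : ∀ B r e′ → B * ((suc e′ + suc e′) * 2) + (r * 2 + 1) + (suc e′ * 2 + suc e′ * 2) + (2 * e′ + 1)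
                       ≡ 2 * ((suc e′ + suc e′) + (B * (suc e′ + suc e′) + r)) + 2 * suc e′
  regroup = solve-∀

module Build {n : ℕ} (anyInput : Fin n) where

  record Draft : Set where
    constructor draft
    field
      {len} : ℕ
      body  : Gates n len
  open Draft public

  record Wire (D : Draft) : Set where
    constructor wire
    field index : Fin (len D + n)
  open Wire public

  eval : (D : Draft) → Vec Bool n → Wire D → Bool
  eval D x w = lookup (wires (body D) x) (index w)

  -- A gate applies an arbitrary function to its inputs, so reading a wire through a unary
  -- function costs nothing: literals provide negations and constants for free.
  record Literal (D : Draft) : Set where
    constructor literal
    field
      source : Wire D
      fn     : Bool → Bool

  evalᴸ : (D : Draft) → Vec Bool n → Literal D → Bool
  evalᴸ D x (literal w f) = f (eval D x w)

  lit : ∀ {D} → Wire D → Literal D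
  lit w = literal w id

  -- A constant reads some input wire and ignores it; this is why a circuit needs an input.
  constᴸ : ∀ D → Bool → Literal D
  constᴸ D b = literal (wire (len D ↑ʳ anyInput)) (const b)

  notᴸ : ∀ {D} → Literal D → Literal D
  notᴸ (literal w f) = literal w (not ∘ f)

  valʷ : (D : Draft) → Vec Bool n → ∀ {m} → Vec (Wire D) m → ℕ
  valʷ D x ws = val (map (eval D x) ws)

  valᴸ : (D : Draft) → Vec Bool n → ∀ {m} → Vec (Literal D) m → ℕ
  valᴸ D x ls = val (map (evalᴸ D x) ls)

  valᴸ-lit : ∀ D (x : Vec Bool n) {m} (ws : Vec (Wire D) m) → valᴸ D x (map lit ws) ≡ valʷ D x ws
  valᴸ-lit D x ws = cong val (sym (map-∘ (evalᴸ D x) lit ws))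

  evalᴸ-notᴸ : ∀ D (x : Vec Bool n) l → evalᴸ D x (notᴸ l) ≡ not (evalᴸ D x l)
  evalᴸ-notᴸ D x (literal w f) = refl

  valᴸ-notᴸ : ∀ D (x : Vec Bool n) {m} (ls : Vec (Literal D) m) →
              valᴸ D x (map notᴸ ls) ≡ val (map not (map (evalᴸ D x) ls))
  valᴸ-notᴸ D x []       = refl
  valᴸ-notᴸ D x (l ∷ ls) = cong (λ v → bit (not (evalᴸ D x l)) + 2 * v) (valᴸ-notᴸ D x ls)

  valᴸ-++ : ∀ D (x : Vec Bool n) {m k} (ls : Vec (Literal D) m) (ls′ : Vec (Literal D) k) →
            valᴸ D x (ls ++ ls′) ≡ valᴸ D x ls + 2 ^ m * valᴸ D x ls′
  valᴸ-++ D x ls ls′ = trans (cong val (map-++ (evalᴸ D x) ls ls′)) (val-++ (map (evalᴸ D x) ls) _)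

  valʷ-++ : ∀ D (x : Vec Bool n) {m k} (ws : Vec (Wire D) m) (ws′ : Vec (Wire D) k) →
            valʷ D x (ws ++ ws′) ≡ valʷ D x ws + 2 ^ m * valʷ D x ws′
  valʷ-++ D x ws ws′ = trans (cong val (map-++ (eval D x) ws ws′)) (val-++ (map (eval D x) ws) _)

  record _⊑⟨_⟩⟨_⟩_ (D : Draft) (k₂ k₃ : ℕ) (D′ : Draft) : Set where
    field
      embed      : Wire D → Wire D′
      eval-embed : ∀ x w → eval D′ x (embed w) ≡ eval D x w
      count2-≡   : count2 (body D′) ≡ k₂ + count2 (body D)
      count3-≡   : count3 (body D′) ≡ k₃ + count3 (body D)
  open _⊑⟨_⟩⟨_⟩_ public

  ⊑-refl : ∀ {D} → D ⊑⟨ 0 ⟩⟨ 0 ⟩ D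
  ⊑-refl = record { embed = id ; eval-embed = λ _ _ → refl ; count2-≡ = refl ; count3-≡ = refl }

  ⊑-trans : ∀ {D D′ D″ k₂ k₃ k₂′ k₃′} → D ⊑⟨ k₂ ⟩⟨ k₃ ⟩ D′ → D′ ⊑⟨ k₂′ ⟩⟨ k₃′ ⟩ D″ →
            D ⊑⟨ k₂ + k₂′ ⟩⟨ k₃ + k₃′ ⟩ D″
  ⊑-trans {k₂ = k₂} {k₃} {k₂′} {k₃′} X Y = record
    { embed      = embed Y ∘ embed X
    ; eval-embed = λ x w → trans (eval-embed Y x (embed X w)) (eval-embed X x w)
    ; count2-≡   = trans (count2-≡ Y) (trans (cong (λ t → k₂′ + t) (count2-≡ X)) (shift k₂ k₂′ _))
    ; count3-≡   = trans (count3-≡ Y) (trans (cong (λ t → k₃′ + t) (count3-≡ X)) (shift k₃ k₃′ _)) }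
    where
    shift : ∀ a b c → b + (a + c) ≡ (a + b) + c
    shift = solve-∀

  ⊑-cast : ∀ {D D′ k₂ k₃ k₂′ k₃′} → k₂ ≡ k₂′ → k₃ ≡ k₃′ →
           D ⊑⟨ k₂ ⟩⟨ k₃ ⟩ D′ → D ⊑⟨ k₂′ ⟩⟨ k₃′ ⟩ D′
  ⊑-cast refl refl X = X

  embedᴸ : ∀ {D D′ k₂ k₃} → D ⊑⟨ k₂ ⟩⟨ k₃ ⟩ D′ → Literal D → Literal D′
  embedᴸ X (literal w f) = literal (embed X w) f

  evalᴸ-embedᴸ : ∀ {D D′ k₂ k₃} (X : D ⊑⟨ k₂ ⟩⟨ k₃ ⟩ D′) (x : Vec Bool n) l →
                 evalᴸ D′ x (embedᴸ X l) ≡ evalᴸ D x l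
  evalᴸ-embedᴸ X x (literal w f) = cong f (eval-embed X x w)

  map-evalᴸ-embedᴸ : ∀ {D D′ k₂ k₃} (X : D ⊑⟨ k₂ ⟩⟨ k₃ ⟩ D′) (x : Vec Bool n) {m} (ls : Vec (Literal D) m) →
                     map (evalᴸ D′ x) (map (embedᴸ X) ls) ≡ map (evalᴸ D x) ls
  map-evalᴸ-embedᴸ X x []       = refl
  map-evalᴸ-embedᴸ X x (l ∷ ls) = cong₂ _∷_ (evalᴸ-embedᴸ X x l) (map-evalᴸ-embedᴸ X x ls)

  valᴸ-embedᴸ : ∀ {D D′ k₂ k₃} (X : D ⊑⟨ k₂ ⟩⟨ k₃ ⟩ D′) (x : Vec Bool n) {m} (ls : Vec (Literal D) m) →
                valᴸ D′ x (map (embedᴸ X) ls) ≡ valᴸ D x ls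
  valᴸ-embedᴸ X x ls = cong val (map-evalᴸ-embedᴸ X x ls)

  valʷ-embed : ∀ {D D′ k₂ k₃} (X : D ⊑⟨ k₂ ⟩⟨ k₃ ⟩ D′) (x : Vec Bool n) {m} (ws : Vec (Wire D) m) →
               valʷ D′ x (map (embed X) ws) ≡ valʷ D x ws
  valʷ-embed X x []       = refl
  valʷ-embed X x (w ∷ ws) = cong₂ (λ b v → bit b + 2 * v) (eval-embed X x w) (valʷ-embed X x ws)

  _⊕_ : (D : Draft) → Gate (len D + n) → Draft
  D ⊕ γ = draft (body D ▷ γ)

  record NewWire (D : Draft) (k₂ k₃ : ℕ) (spec : Vec Bool n → Bool) : Set where
    field
      {result} : Draft
      ext      : D ⊑⟨ k₂ ⟩⟨ k₃ ⟩ result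
      out      : Wire result
      eval-out : ∀ x → eval result x out ≡ spec x

  addGate2 : ∀ D (f : Bool → Bool → Bool) (a b : Literal D) →
             NewWire D 1 0 (λ x → f (evalᴸ D x a) (evalᴸ D x b))
  addGate2 D f (literal u g) (literal v h) = record
    { result   = D ⊕ gate2 (λ p q → f (g p) (h q)) (index u) (index v)
    ; ext      = record { embed      = wire ∘ inject₁ ∘ index
                        ; eval-embed = λ x w → lookup-∷ʳ-inject₁ (wires (body D) x) _ (index w)
                        ; count2-≡   = refl
                        ; count3-≡   = refl }
    ; out      = wire (fromℕ _)
    ; eval-out = λ x → lookup-∷ʳ-fromℕ (wires (body D) x) _ }

  addGate3 : ∀ D (f : Bool → Bool → Bool → Bool) (a b c : Literal D) →
             NewWire D 0 1 (λ x → f (evalᴸ D x a) (evalᴸ D x b) (evalᴸ D x c))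
  addGate3 D f (literal u g) (literal v h) (literal w k) = record
    { result   = D ⊕ gate3 (λ p q r → f (g p) (h q) (k r)) (index u) (index v) (index w)
    ; ext      = record { embed      = wire ∘ inject₁ ∘ index
                        ; eval-embed = λ x w → lookup-∷ʳ-inject₁ (wires (body D) x) _ (index w)
                        ; count2-≡   = refl
                        ; count3-≡   = refl }
    ; out      = wire (fromℕ _)
    ; eval-out = λ x → lookup-∷ʳ-fromℕ (wires (body D) x) _ }

  record Cell (D : Draft) (k₂ k₃ : ℕ) (sumBit carryBit : Vec Bool n → Bool) : Set where
    field
      {result}   : Draft
      ext        : D ⊑⟨ k₂ ⟩⟨ k₃ ⟩ result
      sum carry  : Wire result
      eval-sum   : ∀ x → eval result x sum ≡ sumBit x
      eval-carry : ∀ x → eval result x carry ≡ carryBit x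

  halfAdder : ∀ D (a c : Literal D) →
              Cell D 2 0 (λ x → evalᴸ D x a xor evalᴸ D x c) (λ x → evalᴸ D x a ∧ evalᴸ D x c)
  halfAdder D a c = record
    { ext        = ⊑-trans S.ext C.ext
    ; sum        = embed C.ext S.out
    ; carry      = C.out
    ; eval-sum   = λ x → trans (eval-embed C.ext x S.out) (S.eval-out x)
    ; eval-carry = λ x → trans (C.eval-out x) (cong₂ _∧_ (evalᴸ-embedᴸ S.ext x a) (evalᴸ-embedᴸ S.ext x c)) }
    where
    module S = NewWire (addGate2 D _xor_ a c)
    module C = NewWire (addGate2 S.result _∧_ (embedᴸ S.ext a) (embedᴸ S.ext c))

  fullAdder : ∀ D (a b c : Literal D) →
              Cell D 0 2 (λ x → evalᴸ D x a xor evalᴸ D x b xor evalᴸ D x c)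
                         (λ x → carry₃ (evalᴸ D x a) (evalᴸ D x b) (evalᴸ D x c))
  fullAdder D a b c = record
    { ext        = ⊑-trans S.ext C.ext
    ; sum        = embed C.ext S.out
    ; carry      = C.out
    ; eval-sum   = λ x → trans (eval-embed C.ext x S.out) (S.eval-out x)
    ; eval-carry = λ x → trans (C.eval-out x)
        (cong₂ (λ p (qr : Bool × Bool) → carry₃ p (proj₁ qr) (proj₂ qr)) (evalᴸ-embedᴸ S.ext x a)
               (cong₂ _,_ (evalᴸ-embedᴸ S.ext x b) (evalᴸ-embedᴸ S.ext x c))) }
    where
    module S = NewWire (addGate3 D (λ p q r → p xor q xor r) a b c)
    module C = NewWire (addGate3 S.result carry₃ (embedᴸ S.ext a) (embedᴸ S.ext b) (embedᴸ S.ext c))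

  record Sum (D : Draft) (k₂ k₃ m : ℕ) (total : Vec Bool n → ℕ) : Set where
    field
      {result} : Draft
      ext      : D ⊑⟨ k₂ ⟩⟨ k₃ ⟩ result
      sum      : Vec (Wire result) m
      carry    : Literal result
      correct  : ∀ x → valʷ result x sum + 2 ^ m * bit (evalᴸ result x carry) ≡ total x

  rippleAdder : ∀ {m} D (as bs : Vec (Literal D) m) (c : Literal D) →
                Sum D 0 (m * 2) m (λ x → valᴸ D x as + valᴸ D x bs + bit (evalᴸ D x c))
  rippleAdder D [] [] c = record { ext = ⊑-refl ; sum = [] ; carry = c ; correct = λ x → +-identityʳ _ }
  rippleAdder {suc m} D (a ∷ as) (b ∷ bs) c = record
    { ext = ⊑-trans F.ext R.ext ; sum = embed R.ext F.sum ∷ R.sum ; carry = R.carry ; correct = correct }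
    where
    module F = Cell (fullAdder D a b c)
    module R = Sum (rippleAdder F.result (map (embedᴸ F.ext) as) (map (embedᴸ F.ext) bs) (lit F.carry))
    regroup : ∀ a b c A B → (a + b + 2 * (A + B)) + c ≡ (a + 2 * A) + (b + 2 * B) + c
    regroup = solve-∀
    correct : ∀ x → valʷ R.result x (embed R.ext F.sum ∷ R.sum) + 2 ^ suc m * bit (evalᴸ R.result x R.carry)
                    ≡ valᴸ D x (a ∷ as) + valᴸ D x (b ∷ bs) + bit (evalᴸ D x c)
    correct x = trans (ripple-step {s} {v} {2 ^ m} {k} {A + B} {k₁} {bit a′ + bit b′} {bit c′} high low)
                      (regroup (bit a′) (bit b′) (bit c′) A B)
      where
      s  = bit (eval R.result x (embed R.ext F.sum))
      v  = valʷ R.result x R.sum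
      k  = bit (evalᴸ R.result x R.carry)
      k₁ = bit (eval F.result x F.carry)
      a′ = evalᴸ D x a
      b′ = evalᴸ D x b
      c′ = evalᴸ D x c
      A  = valᴸ D x as
      B  = valᴸ D x bs
      high : valʷ R.result x R.sum + 2 ^ m * bit (evalᴸ R.result x R.carry)
             ≡ (valᴸ D x as + valᴸ D x bs) + bit (eval F.result x F.carry)
      high = trans (R.correct x) (cong₂ (λ u v → u + v + _) (valᴸ-embedᴸ F.ext x as) (valᴸ-embedᴸ F.ext x bs))
      low : bit (eval R.result x (embed R.ext F.sum)) + 2 * bit (eval F.result x F.carry)
            ≡ (bit (evalᴸ D x a) + bit (evalᴸ D x b)) + bit (evalᴸ D x c)
      low = trans (cong₂ (λ s k → bit s + 2 * bit k) (trans (eval-embed R.ext x F.sum) (F.eval-sum x)) (F.eval-carry x))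
                  (bit-xor-carry₃ a′ b′ c′)

  incrementer : ∀ {m} D (as : Vec (Literal D) m) (c : Literal D) →
                Sum D (m * 2) 0 m (λ x → valᴸ D x as + bit (evalᴸ D x c))
  incrementer D [] c = record { ext = ⊑-refl ; sum = [] ; carry = c ; correct = λ x → +-identityʳ _ }
  incrementer {suc m} D (a ∷ as) c = record
    { ext = ⊑-trans H.ext R.ext ; sum = embed R.ext H.sum ∷ R.sum ; carry = R.carry ; correct = correct }
    where
    module H = Cell (halfAdder D a c)
    module R = Sum (incrementer H.result (map (embedᴸ H.ext) as) (lit H.carry))
    correct : ∀ x → valʷ R.result x (embed R.ext H.sum ∷ R.sum) + 2 ^ suc m * bit (evalᴸ R.result x R.carry)
                    ≡ valᴸ D x (a ∷ as) + bit (evalᴸ D x c)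
    correct x = ripple-step {s} {v} {2 ^ m} {k} {valᴸ D x as} {k₁} {bit (evalᴸ D x a)} {bit (evalᴸ D x c)} high low
      where
      s  = bit (eval R.result x (embed R.ext H.sum))
      v  = valʷ R.result x R.sum
      k  = bit (evalᴸ R.result x R.carry)
      k₁ = bit (eval H.result x H.carry)
      high : valʷ R.result x R.sum + 2 ^ m * bit (evalᴸ R.result x R.carry)
             ≡ valᴸ D x as + bit (eval H.result x H.carry)
      high = trans (R.correct x) (cong (_+ _) (valᴸ-embedᴸ H.ext x as))
      low : bit (eval R.result x (embed R.ext H.sum)) + 2 * bit (eval H.result x H.carry)
            ≡ bit (evalᴸ D x a) + bit (evalᴸ D x c)
      low = trans (cong₂ (λ s k → bit s + 2 * bit k) (trans (eval-embed R.ext x H.sum) (H.eval-sum x)) (H.eval-carry x))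
                  (bit-xor-∧ (evalᴸ D x a) (evalᴸ D x c))

  -- Circuit outputs are wires, so the top carry of an (e + 1)-bit result has to be one.
  incrementer-carry-wire : ∀ {m} D (as : Vec (Literal D) (suc m)) (c : Literal D) →
                           ∃[ w ] Sum.carry (incrementer D as c) ≡ lit w
  incrementer-carry-wire D (a ∷ [])     c = _ , refl
  incrementer-carry-wire D (a ∷ b ∷ as) c = incrementer-carry-wire _ (map (embedᴸ (Cell.ext (halfAdder D a c))) (b ∷ as)) _

  record Word (D : Draft) (k₂ k₃ m : ℕ) (Spec : Vec Bool n → ℕ → Set) : Set where
    field
      {result} : Draft
      ext      : D ⊑⟨ k₂ ⟩⟨ k₃ ⟩ result
      bits     : Vec (Wire result) m
      correct  : ∀ x → Spec x (valʷ result x bits)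

  valʷ-head-tail : ∀ D (x : Vec Bool n) {m} (ws : Vec (Wire D) (suc m)) →
                   valʷ D x ws ≡ bit (eval D x (head ws)) + 2 * valʷ D x (tail ws)
  valʷ-head-tail D x (w ∷ ws) = refl

  -- As c is set only when ws is zero, xor-ing c into the lowest bit adds it.  The gate reads c twice,
  -- making it fan-in 3: no fan-in-2 gate is left in the budget.
  absorbCarry : ∀ {m} D (ws : Vec (Wire D) (suc m)) (c : Literal D) →
                (∀ x → evalᴸ D x c ≡ true → valʷ D x ws ≡ 0) →
                Word D 0 1 (suc m) (λ x v → v ≡ valʷ D x ws + bit (evalᴸ D x c))
  absorbCarry D ws c c⇒ws≡0 = record
    { ext     = G.ext
    ; bits    = G.out ∷ map (embed G.ext) (tail ws)
    ; correct = λ x → begin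
        bit (eval G.result x G.out) + 2 * valʷ G.result x (map (embed G.ext) (tail ws))
          ≡⟨ cong₂ (λ b v → bit b + 2 * v) (G.eval-out x) (valʷ-embed G.ext x (tail ws)) ⟩
        bit (eval D x (head ws) xor evalᴸ D x c) + 2 * valʷ D x (tail ws)
          ≡⟨ bit-xor-absorbs (eval D x (head ws)) _ (valʷ D x (tail ws)) (c⇒low-clear x) ⟩
        bit (eval D x (head ws)) + 2 * valʷ D x (tail ws) + bit (evalᴸ D x c)
          ≡⟨ cong (_+ bit (evalᴸ D x c)) (valʷ-head-tail D x ws) ⟨
        valʷ D x ws + bit (evalᴸ D x c) ∎ }
    where
    open ≡-Reasoning
    module G = NewWire (addGate3 D (λ p q _ → p xor q) (lit (head ws)) c c)
    c⇒low-clear : ∀ x → evalᴸ D x c ≡ true → eval D x (head ws) ≡ false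
    c⇒low-clear x c≡1 = bit-head≡0 _ (valʷ D x (tail ws)) (trans (sym (valʷ-head-tail D x ws)) (c⇒ws≡0 x c≡1))

  -- Addition modulo M = 2^W − 1 of W-bit blocks, W = r + suc h, where r is the width of the last,
  -- partial block.
  module EndAroundCarry (r h M : ℕ) (2^W≡1+M : 2 ^ (r + suc h) ≡ suc M) where

    W : ℕ
    W = r + suc h

    stateValue : (D : Draft) → Vec Bool n → Vec (Literal D) W → Literal D → ∀ {m} → Vec (Literal D) m → ℕ
    stateValue D x acc c ys = valᴸ D x acc + bit (evalᴸ D x c) + suc M * valᴸ D x ys

    blocksThen : ℕ → ℕ
    blocksThen zero    = r
    blocksThen (suc B) = W + blocksThen B

    blocksThen≡ : ∀ B → blocksThen B ≡ B * W + r
    blocksThen≡ zero    = refl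
    blocksThen≡ (suc B) = trans (cong (λ t → W + t) (blocksThen≡ B)) (sym (+-assoc W (B * W) r))

    record Folded (D : Draft) (B : ℕ) (acc : Vec (Literal D) W) (c : Literal D)
                  (xs : Vec (Literal D) (blocksThen B)) : Set where
      field
        {result} : Draft
        ext      : D ⊑⟨ 0 ⟩⟨ B * (W * 2) ⟩ result
        acc′     : Vec (Literal result) W
        carry′   : Literal result
        rest     : Vec (Literal result) r
        correct  : ∀ x → stateValue D x acc c xs ≋ stateValue result x acc′ carry′ rest mod M

    foldBlocks : ∀ B D acc c xs → Folded D B acc c xs
    foldBlocks zero D acc c xs = record
      { ext = ⊑-refl ; acc′ = acc ; carry′ = c ; rest = xs ; correct = λ x → ≋-refl }
    foldBlocks (suc B) D acc c xs = record
      { ext = ⊑-trans A.ext R.ext ; acc′ = R.acc′ ; carry′ = R.carry′ ; rest = R.rest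
      ; correct = λ x → ≋-trans (block x) (R.correct x) }
      where
      blk  = proj₁ (splitAt W xs)
      more = proj₁ (proj₂ (splitAt W xs))
      xs≡ : xs ≡ blk ++ more
      xs≡ = proj₂ (proj₂ (splitAt W xs))
      module A = Sum (rippleAdder D acc blk c)
      module R = Folded (foldBlocks B A.result (map lit A.sum) A.carry (map (embedᴸ A.ext) more))
      block : ∀ x → stateValue D x acc c xs ≋ stateValue A.result x (map lit A.sum) A.carry (map (embedᴸ A.ext) more) mod M
      block x = ≋-resp (cong (λ v → a + k + suc M * v) (sym xs-value))
                       (cong₂ (λ u v → u + k′ + suc M * v) (sym (valᴸ-lit A.result x A.sum))
                                                            (sym (valᴸ-embedᴸ A.ext x more)))
                       (end-around-block {a} {b} {k} {valᴸ D x more} {s} {k′} {M}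
                          (trans (cong (λ p → s + p * k′) (sym 2^W≡1+M)) (A.correct x)))
        where
        a  = valᴸ D x acc
        b  = valᴸ D x blk
        k  = bit (evalᴸ D x c)
        s  = valʷ A.result x A.sum
        k′ = bit (evalᴸ A.result x A.carry)
        xs-value : valᴸ D x xs ≡ b + suc M * valᴸ D x more
        xs-value = trans (cong (valᴸ D x) xs≡) (trans (valᴸ-++ D x blk more)
                         (cong (λ p → b + p * valᴸ D x more) 2^W≡1+M))

    foldRemainder : ∀ D acc c (ys : Vec (Literal D) r) →
                    Word D (W * 2) (r * 2 + 1) W (λ x v → stateValue D x acc c ys ≋ v mod M)
    foldRemainder D acc c ys = record
      { ext     = ⊑-cast (two-gates r h) (one-more r) (⊑-trans (⊑-trans (⊑-trans A.ext I₁.ext) I₂.ext) F.ext)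
      ; bits    = map (embed F.ext) I₂.sum ++ F.bits
      ; correct = correct }
      where
      two-gates : ∀ r h → ((0 + suc h * 2) + r * 2) + 0 ≡ (r + suc h) * 2
      two-gates = solve-∀
      one-more : ∀ r → ((r * 2 + 0) + 0) + 1 ≡ r * 2 + 1
      one-more = solve-∀
      lo = proj₁ (splitAt r acc)
      hi = proj₁ (proj₂ (splitAt r acc))
      acc≡ : acc ≡ lo ++ hi
      acc≡ = proj₂ (proj₂ (splitAt r acc))
      module A  = Sum (rippleAdder D lo ys c)
      module I₁ = Sum (incrementer A.result (map (embedᴸ A.ext) hi) A.carry)
      module I₂ = Sum (incrementer I₁.result (map lit (map (embed I₁.ext) A.sum)) I₁.carry)
      module _ (x : Vec Bool n) where
        Lo₁ = valʷ A.result x A.sum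
        Hi₁ = valʷ I₁.result x I₁.sum
        Lo₂ = valʷ I₂.result x I₂.sum
        c₁  = evalᴸ A.result x A.carry
        c₂  = evalᴸ I₁.result x I₁.carry
        c₃  = evalᴸ I₂.result x I₂.carry
        high : Hi₁ + 2 ^ suc h * bit c₂ ≡ valᴸ D x hi + bit c₁
        high = trans (I₁.correct x) (cong (_+ bit c₁) (valᴸ-embedᴸ A.ext x hi))
        low : Lo₂ + 2 ^ r * bit c₃ ≡ Lo₁ + bit c₂
        low = trans (I₂.correct x) (cong (_+ bit c₂)
                (trans (valᴸ-lit I₁.result x (map (embed I₁.ext) A.sum)) (valʷ-embed I₁.ext x A.sum)))
        high-clear : c₃ ≡ true → valʷ I₂.result x (map (embed I₂.ext) I₁.sum) ≡ 0
        high-clear c₃≡1 = trans (valʷ-embed I₂.ext x I₁.sum)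
          (overflow-twice⇒zero c₁ c₂ c₃ (val<2^ (map (eval A.result x) A.sum))
                                (val<2^ (map (evalᴸ D x) hi)) high low c₃≡1)
      module F = Word (absorbCarry I₂.result (map (embed I₂.ext) I₁.sum) I₂.carry high-clear)
      bits-value : ∀ x → valʷ F.result x (map (embed F.ext) I₂.sum ++ F.bits) ≡ Lo₂ x + 2 ^ r * (Hi₁ x + bit (c₃ x))
      bits-value x = begin
        valʷ F.result x (map (embed F.ext) I₂.sum ++ F.bits)
          ≡⟨ valʷ-++ F.result x (map (embed F.ext) I₂.sum) F.bits ⟩
        valʷ F.result x (map (embed F.ext) I₂.sum) + 2 ^ r * valʷ F.result x F.bits
          ≡⟨ cong₂ (λ u v → u + 2 ^ r * v) (valʷ-embed F.ext x I₂.sum) (F.correct x) ⟩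
        Lo₂ x + 2 ^ r * (valʷ I₂.result x (map (embed I₂.ext) I₁.sum) + bit (c₃ x))
          ≡⟨ cong (λ v → Lo₂ x + 2 ^ r * (v + bit (c₃ x))) (valʷ-embed I₂.ext x I₁.sum) ⟩
        Lo₂ x + 2 ^ r * (Hi₁ x + bit (c₃ x)) ∎
        where open ≡-Reasoning
      correct : ∀ x → stateValue D x acc c ys ≋ valʷ F.result x (map (embed F.ext) I₂.sum ++ F.bits) mod M
      correct x = ≋-resp (cong (λ v → v + bit (evalᴸ D x c) + suc M * valᴸ D x ys)
                               (sym (trans (cong (valᴸ D x) acc≡) (valᴸ-++ D x lo hi))))
                         (sym (bits-value x))
                         (fold-remainder {valᴸ D x lo} {valᴸ D x hi} {valᴸ D x ys} {bit (evalᴸ D x c)}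
                                         {Lo₁ x} {bit (c₁ x)} {Hi₁ x} {bit (c₂ x)} {Lo₂ x} {bit (c₃ x)}
                                         {2 ^ r} {2 ^ suc h} {M}
                                         (trans (sym (^-distribˡ-+-* 2 r (suc h))) 2^W≡1+M)
                                         (A.correct x) (high x) (low x))

    reduce : ∀ B D {m} → m ≡ W + blocksThen B → (xs : Vec (Literal D) m) →
             Word D (W * 2) (B * (W * 2) + (r * 2 + 1)) W (λ x v → valᴸ D x xs ≋ v mod M)
    reduce B D refl xs = record
      { ext = ⊑-trans F.ext R.ext ; bits = R.bits
      ; correct = λ x → ≋-trans (≡⇒≋ (xs-value x)) (≋-trans (F.correct x) (R.correct x)) }
      where
      acc : Vec (Literal D) W
      acc = proj₁ (splitAt W xs)
      more : Vec (Literal D) (blocksThen B)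
      more = proj₁ (proj₂ (splitAt W xs))
      xs≡ : xs ≡ acc ++ more
      xs≡ = proj₂ (proj₂ (splitAt W xs))
      module F = Folded (foldBlocks B D acc (constᴸ D false) more)
      module R = Word (foldRemainder F.result F.acc′ F.carry′ F.rest)
      xs-value : ∀ x → valᴸ D x xs ≡ stateValue D x acc (constᴸ D false) more
      xs-value x = trans (cong (valᴸ D x) xs≡) (trans (valᴸ-++ D x acc more)
                     (cong₂ (λ u p → u + p * valᴸ D x more) (sym (+-identityʳ (valᴸ D x acc))) 2^W≡1+M))

  empty : Draft
  empty = draft []

  inputWires : Vec (Wire empty) n
  inputWires = map wire (allFin n)

  valʷ-inputWires : ∀ x → valʷ empty x inputWires ≡ val x
  valʷ-inputWires x = cong val (begin
    map (eval empty x) (map wire (allFin n))  ≡⟨ map-∘ (eval empty x) wire (allFin n) ⟨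
    map (lookup x) (tabulate id)      ≡⟨ tabulate-∘ (lookup x) id ⟨
    tabulate (lookup x)               ≡⟨ tabulate∘lookup x ⟩
    x                                          ∎)
    where open ≡-Reasoning

  inputs : Vec (Literal empty) n
  inputs = map lit inputWires

  valᴸ-inputs : ∀ x → valᴸ empty x inputs ≡ val x
  valᴸ-inputs x = trans (valᴸ-lit empty x inputWires) (valʷ-inputWires x)

  padding : ∀ k₂ k₃ D → Σ[ D′ ∈ Draft ] D ⊑⟨ k₂ ⟩⟨ k₃ ⟩ D′
  padding zero     zero     D = D , ⊑-refl
  padding (suc k₂) k₃       D = map₂ (⊑-trans (NewWire.ext G)) (padding k₂ k₃ (NewWire.result G))
    where G = addGate2 D (λ _ _ → false) (constᴸ D false) (constᴸ D false)
  padding zero     (suc k₃) D = map₂ (⊑-trans (NewWire.ext G)) (padding zero k₃ (NewWire.result G))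
    where G = addGate3 D (λ _ _ _ → false) (constᴸ D false) (constᴸ D false) (constᴸ D false)

  toCircuit : ∀ {m D k₂ k₃ t₂ t₃} → empty ⊑⟨ k₂ ⟩⟨ k₃ ⟩ D → k₂ ≤ t₂ → k₃ ≤ t₃ → (outs : Vec (Wire D) m) →
              Σ[ C ∈ Circuit n m ] count2 (gates C) ≡ t₂ × count3 (gates C) ≡ t₃ ×
                                   (∀ x → run C x ≡ map (eval D x) outs)
  toCircuit {D = D} {k₂} {k₃} {t₂} {t₃} X k₂≤t₂ k₃≤t₃ outs =
    record { size = len D′ ; gates = body D′ ; outputs = map (index ∘ embed P) outs } ,
    trans (count2-≡ (⊑-trans X P)) (trans (+-identityʳ _) (m+[n∸m]≡n k₂≤t₂)) ,
    trans (count3-≡ (⊑-trans X P)) (trans (+-identityʳ _) (m+[n∸m]≡n k₃≤t₃)) ,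
    λ x → trans (sym (map-∘ (lookup (wires (body D′) x)) (index ∘ embed P) outs)) (map-cong (eval-embed P x) outs)
    where
    D′ = proj₁ (padding (t₂ ∸ k₂) (t₃ ∸ k₃) D)
    P  = proj₂ (padding (t₂ ∸ k₂) (t₃ ∸ k₃) D)

  module Residues (e′ : ℕ) where

    e : ℕ
    e = suc e′

    a : ℕ
    a = 2 ^ e ∸ 1

    2^e≡1+a : 2 ^ e ≡ suc a
    2^e≡1+a = sym (trans (+-comm 1 a) (m∸n+n≡m (m^n>0 2 e)))

    2^[e+e]≡1+M : 2 ^ (e + e) ≡ suc (a * suc (2 ^ e))
    2^[e+e]≡1+M = begin
      2 ^ (e + e)            ≡⟨ ^-distribˡ-+-* 2 e e ⟩
      2 ^ e * 2 ^ e          ≡⟨ cong₂ _*_ 2^e≡1+a 2^e≡1+a ⟩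
      suc a * suc a          ≡⟨ square a ⟩
      suc (a * suc (suc a))  ≡⟨ cong (λ t → suc (a * suc t)) 2^e≡1+a ⟨
      suc (a * suc (2 ^ e))  ∎
      where
      open ≡-Reasoning
      square : ∀ a → suc a * suc a ≡ suc (a * suc (suc a))
      square = solve-∀

    ResiduesOf : ℕ → ℕ → ℕ → Set
    ResiduesOf v r⁻ r⁺ = v ≋ r⁻ mod a × r⁺ < suc (2 ^ e) × v ≋ r⁺ mod suc (2 ^ e)

    ResiduesOf-≋ : ∀ {v w r⁻ r⁺} → v ≋ w mod (a * suc (2 ^ e)) → ResiduesOf w r⁻ r⁺ → ResiduesOf v r⁻ r⁺
    ResiduesOf-≋ v≋w (w≋r⁻ , r⁺< , w≋r⁺) =
      ≋-trans (≋-mod-*ʳ a _ v≋w) w≋r⁻ , r⁺< , ≋-trans (≋-mod-*ˡ a _ v≋w) w≋r⁺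

    record ResidueDraft (D : Draft) (k₂ k₃ : ℕ) (value : Vec Bool n → ℕ) : Set where
      field
        {result} : Draft
        ext      : D ⊑⟨ k₂ ⟩⟨ k₃ ⟩ result
        mod⁻     : Vec (Wire result) e
        mod⁺     : Vec (Wire result) (e + 1)
        correct  : ∀ x → ResiduesOf (value x) (valʷ result x mod⁻) (valʷ result x mod⁺)

    endAroundSum : ∀ D (lo hi : Vec (Literal D) e) →
                   Word D (e * 2) (e * 2) e (λ x v → valᴸ D x lo + 2 ^ e * valᴸ D x hi ≋ v mod a)
    endAroundSum D lo hi = record
      { ext     = ⊑-cast (+-identityˡ (e * 2)) (+-identityʳ (e * 2)) (⊑-trans A.ext I.ext)
      ; bits    = I.sum
      ; correct = λ x → subst (λ t → valᴸ D x lo + t * valᴸ D x hi ≋ valʷ I.result x I.sum mod a) (sym 2^e≡1+a)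
                              (end-around-sum (c₁ x) (c₂ x) (bound x lo) (bound x hi) (S<t x) (sum≡ x) (inc≡ x)) }
      where
      module A = Sum (rippleAdder D lo hi (constᴸ D false))
      module I = Sum (incrementer A.result (map lit A.sum) A.carry)
      module _ (x : Vec Bool n) where
        S  = valʷ A.result x A.sum
        c₁ = evalᴸ A.result x A.carry
        c₂ = evalᴸ I.result x I.carry
        bound : (ls : Vec (Literal D) e) → valᴸ D x ls < suc a
        bound ls = subst (valᴸ D x ls <_) 2^e≡1+a (val<2^ (map (evalᴸ D x) ls))
        S<t : S < suc a
        S<t = subst (S <_) 2^e≡1+a (val<2^ (map (eval A.result x) A.sum))
        sum≡ : S + suc a * bit c₁ ≡ valᴸ D x lo + valᴸ D x hi + 0
        sum≡ = trans (cong (λ t → S + t * bit c₁) (sym 2^e≡1+a)) (A.correct x)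
        inc≡ : valʷ I.result x I.sum + suc a * bit c₂ ≡ S + bit c₁
        inc≡ = trans (cong (λ t → valʷ I.result x I.sum + t * bit c₂) (sym 2^e≡1+a))
                     (trans (I.correct x) (cong (_+ bit c₁) (valᴸ-lit A.result x A.sum)))

    complementSum : ∀ D (lo hi : Vec (Literal D) e) →
                    Word D (e * 2) (e * 2) (e + 1)
                         (λ x v → v < suc (2 ^ e) × valᴸ D x lo + 2 ^ e * valᴸ D x hi ≋ v mod suc (2 ^ e))
    complementSum D lo hi = record
      { ext     = ⊑-cast (+-identityˡ (e * 2)) (+-identityʳ (e * 2)) (⊑-trans A.ext I.ext)
      ; bits    = I.sum ++ w ∷ []
      ; correct = λ x → subst (λ v → v < suc (2 ^ e) × valᴸ D x lo + 2 ^ e * valᴸ D x hi ≋ v mod suc (2 ^ e))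
                              (sym (bits-value x))
                              (difference-mod-suc (b x) (val<2^ (map (eval A.result x) A.sum))
                                                  (val-map-not (map (evalᴸ D x) hi)) (sum≡ x)) }
      where
      module A = Sum (rippleAdder D lo (map notᴸ hi) (constᴸ D true))
      module I = Sum (incrementer A.result (map lit A.sum) (notᴸ A.carry))
      w : Wire I.result
      w = proj₁ (incrementer-carry-wire A.result (map lit A.sum) (notᴸ A.carry))
      carry≡w : I.carry ≡ lit w
      carry≡w = proj₂ (incrementer-carry-wire A.result (map lit A.sum) (notᴸ A.carry))
      module _ (x : Vec Bool n) where
        T = valʷ A.result x A.sum
        b = evalᴸ A.result x A.carry
        sum≡ : T + 2 ^ e * bit b ≡ valᴸ D x lo + val (map not (map (evalᴸ D x) hi)) + 1
        sum≡ = trans (A.correct x) (cong (λ v → valᴸ D x lo + v + 1) (valᴸ-notᴸ D x hi))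
        bits-value : valʷ I.result x (I.sum ++ w ∷ []) ≡ T + bit (not b)
        bits-value = begin
          valʷ I.result x (I.sum ++ w ∷ [])
            ≡⟨ valʷ-++ I.result x I.sum (w ∷ []) ⟩
          valʷ I.result x I.sum + 2 ^ e * (bit (eval I.result x w) + 2 * 0)
            ≡⟨ cong (λ t → valʷ I.result x I.sum + 2 ^ e * t)
                    (trans (+-identityʳ _) (cong (bit ∘ evalᴸ I.result x) (sym carry≡w))) ⟩
          valʷ I.result x I.sum + 2 ^ e * bit (evalᴸ I.result x I.carry)
            ≡⟨ I.correct x ⟩
          valᴸ A.result x (map lit A.sum) + bit (evalᴸ A.result x (notᴸ A.carry))
            ≡⟨ cong₂ (λ u v → u + bit v) (valᴸ-lit A.result x A.sum) (evalᴸ-notᴸ A.result x A.carry) ⟩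
          T + bit (not b) ∎
          where open ≡-Reasoning

    splitModuli : ∀ D {m} → m ≡ e + e → (R : Vec (Literal D) m) →
                  ResidueDraft D (e * 2 + e * 2) (e * 2 + e * 2) (λ x → valᴸ D x R)
    splitModuli D refl R = record
      { ext     = ⊑-trans S⁻.ext S⁺.ext
      ; mod⁻    = map (embed S⁺.ext) S⁻.bits
      ; mod⁺    = S⁺.bits
      ; correct = λ x → ≋-resp (sym (R-value x)) (sym (valʷ-embed S⁺.ext x S⁻.bits)) (S⁻.correct x)
                      , proj₁ (S⁺.correct x)
                      , ≋-resp (sym (R-value x)) refl
                               (≋-resp (cong₂ (λ u v → u + 2 ^ e * v) (valᴸ-embedᴸ S⁻.ext x lo)
                                                                      (valᴸ-embedᴸ S⁻.ext x hi))
                                       refl (proj₂ (S⁺.correct x))) }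
      where
      lo hi : Vec (Literal D) e
      lo = proj₁ (splitAt e R)
      hi = proj₁ (proj₂ (splitAt e R))
      module S⁻ = Word (endAroundSum D lo hi)
      module S⁺ = Word (complementSum S⁻.result (map (embedᴸ S⁻.ext) lo) (map (embedᴸ S⁻.ext) hi))
      R-value : ∀ x → valᴸ D x R ≡ valᴸ D x lo + 2 ^ e * valᴸ D x hi
      R-value x = trans (cong (valᴸ D x) (proj₂ (proj₂ (splitAt e R)))) (valᴸ-++ D x lo hi)

    ResidueDraft-≋ : ∀ {D k₂ k₃ v w} → (∀ x → v x ≋ w x mod (a * suc (2 ^ e))) →
                     ResidueDraft D k₂ k₃ w → ResidueDraft D k₂ k₃ v
    ResidueDraft-≋ v≋w S = record
      { ext = ext ; mod⁻ = mod⁻ ; mod⁺ = mod⁺ ; correct = λ x → ResiduesOf-≋ (v≋w x) (correct x) }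
      where open ResidueDraft S

    ResidueDraft-after : ∀ {D D′ k₂ k₃ k₂′ k₃′ v} → D ⊑⟨ k₂ ⟩⟨ k₃ ⟩ D′ →
                         ResidueDraft D′ k₂′ k₃′ v → ResidueDraft D (k₂ + k₂′) (k₃ + k₃′) v
    ResidueDraft-after X S = record { ext = ⊑-trans X ext ; mod⁻ = mod⁻ ; mod⁺ = mod⁺ ; correct = correct }
      where open ResidueDraft S

    record Budgeted : Set where
      field
        {k₂ k₃} : ℕ
        residues : ResidueDraft empty k₂ k₃ val
        k₂≤      : k₂ ≤ 4 * e + 2 * (n ∸ n % e)
        k₃≤      : k₃ ≤ 2 * n + 2 * e

    residueCircuit : Budgeted →
      Σ (Circuit n (e + (e + 1))) λ C →
        (count3 (gates C) ≡ 2 * n + 2 * e) ×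
        (count2 (gates C) ≡ 4 * e + 2 * (n ∸ n % e)) ×
        ((x : Vec Bool n) →
          ((+ (2 ^ e ∸ 1)) ∣ (+ val (take e (run C x)) - + val x)) ×
          (val (drop e (run C x)) ≡ val x % suc (2 ^ e)))
    residueCircuit b = C , count₃ , count₂ , λ x →
      let (take≡ , drop≡) = take-drop-++ (run C x) (map (eval S.result x) S.mod⁻) (map (eval S.result x) S.mod⁺)
                              (trans (runs x) (map-++ (eval S.result x) S.mod⁻ S.mod⁺))
          (x≋r⁻ , r⁺< , x≋r⁺) = S.correct x
      in subst (λ v → + a ∣ + val v - + val x) (sym take≡) (≋⇒∣ x≋r⁻) ,
         trans (cong val drop≡) (sym (≋⇒%≡ r⁺< x≋r⁺))
      where
      open Budgeted b
      module S = ResidueDraft residues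
      circuit = toCircuit S.ext k₂≤ k₃≤ (S.mod⁻ ++ S.mod⁺)
      C : Circuit n (e + (e + 1))
      C = proj₁ circuit
      count₂ : count2 (gates C) ≡ 4 * e + 2 * (n ∸ n % e)
      count₂ = proj₁ (proj₂ circuit)
      count₃ : count3 (gates C) ≡ 2 * n + 2 * e
      count₃ = proj₁ (proj₂ (proj₂ circuit))
      runs : ∀ x → run C x ≡ map (eval S.result x) (S.mod⁻ ++ S.mod⁺)
      runs = proj₂ (proj₂ (proj₂ circuit))

    residues-short : n < e → Budgeted
    residues-short n<e = record
      { residues = record
          { ext     = G.ext
          ; mod⁻    = padRight (<⇒≤ n<e) G.out inputsʷ
          ; mod⁺    = padRight n≤e+1 G.out inputsʷ
          ; correct = λ x → ≡⇒≋ (sym (padded (<⇒≤ n<e) x))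
                          , subst (_< suc (2 ^ e)) (sym (padded n≤e+1 x)) (val<2^e+1 x)
                          , ≡⇒≋ (sym (padded n≤e+1 x)) }
      ; k₂≤ = s≤s z≤n
      ; k₃≤ = z≤n }
      where
      module G = NewWire (addGate2 empty (λ _ _ → false) (constᴸ empty false) (constᴸ empty false))
      inputsʷ = map (embed G.ext) inputWires
      n≤e+1 : n ≤ e + 1
      n≤e+1 = ≤-trans (<⇒≤ n<e) (m≤m+n e 1)
      padded : ∀ {k} (n≤k : n ≤ k) x → valʷ G.result x (padRight n≤k G.out inputsʷ) ≡ val x
      padded n≤k x = trans (val-map-padRight (eval G.result x) (G.eval-out x) n≤k inputsʷ)
                           (trans (valʷ-embed G.ext x inputWires) (valʷ-inputWires x))
      val<2^e+1 : ∀ x → val x < suc (2 ^ e)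
      val<2^e+1 x = ≤-trans (val<2^ x) (≤-trans (^-monoʳ-≤ 2 (<⇒≤ n<e)) (n≤1+n (2 ^ e)))

    residues-medium : e ≤ n → n ≤ e + e → Budgeted
    residues-medium e≤n n≤2e = record
      { residues = ResidueDraft-≋ (λ x → ≡⇒≋ (sym (padded x))) (splitModuli empty refl R)
      ; k₂≤ = ≤-trans (≤-reflexive (four e)) (m≤m+n (4 * e) _)
      ; k₃≤ = ≤-trans (≤-reflexive (trans (four e) (twice-two e))) (+-monoˡ-≤ (2 * e) (*-monoʳ-≤ 2 e≤n)) }
      where
      R = padRight n≤2e (constᴸ empty false) inputs
      padded : ∀ x → valᴸ empty x R ≡ val x
      padded x = trans (val-map-padRight (evalᴸ empty x) refl n≤2e inputs) (valᴸ-inputs x)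
      four : ∀ e → e * 2 + e * 2 ≡ 4 * e
      four = solve-∀
      twice-two : ∀ e → 4 * e ≡ 2 * e + 2 * e
      twice-two = solve-∀

    residues-long : e + e ≤ n → Budgeted
    residues-long 2e≤n = record { residues = residues ; k₂≤ = k₂≤ ; k₃≤ = k₃≤ }
      where
      r  = (n ∸ (e + e)) % (e + e)
      B  = (n ∸ (e + e)) / (e + e)
      h  = (e + e) ∸ suc r
      W≡ : r + suc h ≡ e + e
      W≡ = trans (+-suc r h) (m+[n∸m]≡n (m%n<n (n ∸ (e + e)) (e + e)))
      n≡ : n ≡ (e + e) + (B * (e + e) + r)
      n≡ = trans (sym (m+[n∸m]≡n 2e≤n))
                 (cong (λ t → (e + e) + t) (trans (m≡m%n+[m/n]*n (n ∸ (e + e)) (e + e)) (+-comm r (B * (e + e)))))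
      module EAC = EndAroundCarry r h (a * suc (2 ^ e)) (trans (cong (2 ^_) W≡) 2^[e+e]≡1+M)
      W≡e+e : EAC.W ≡ e + e
      W≡e+e = W≡
      n≡blocks : n ≡ EAC.W + EAC.blocksThen B
      n≡blocks = trans n≡ (trans (cong (λ w → w + (B * w + r)) (sym W≡))
                                 (cong (λ t → EAC.W + t) (sym (EAC.blocksThen≡ B))))
      module Red = Word (EAC.reduce B empty n≡blocks inputs)
      value≋ : ∀ x → val x ≋ valᴸ Red.result x (map lit Red.bits) mod (a * suc (2 ^ e))
      value≋ x = ≋-resp (valᴸ-inputs x) (sym (valᴸ-lit Red.result x Red.bits)) (Red.correct x)
      k₂≤ : EAC.W * 2 + (e * 2 + e * 2) ≤ 4 * e + 2 * (n ∸ n % e)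
      k₂≤ = subst (λ w → w * 2 + (e * 2 + e * 2) ≤ 4 * e + 2 * (n ∸ n % e)) (sym W≡) (long-budget₂ e n 2e≤n)
      k₃≤ : B * (EAC.W * 2) + (r * 2 + 1) + (e * 2 + e * 2) ≤ 2 * n + 2 * e
      k₃≤ = subst₂ (λ w m → B * (w * 2) + (r * 2 + 1) + (e * 2 + e * 2) ≤ 2 * m + 2 * e)
                   (sym W≡) (sym n≡) (long-budget₃ B r e′)
      residues : ResidueDraft empty (EAC.W * 2 + (e * 2 + e * 2)) (B * (EAC.W * 2) + (r * 2 + 1) + (e * 2 + e * 2)) val
      residues = ResidueDraft-≋ value≋ (ResidueDraft-after Red.ext (splitModuli Red.result W≡e+e (map lit Red.bits)))

    withinBudget : Budgeted
    withinBudget with n <? e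
    ... | yes n<e = residues-short n<e
    ... | no  n≮e with n ≤? e + e
    ...   | yes n≤2e = residues-medium (≮⇒≥ n≮e) n≤2e
    ...   | no  n≰2e = residues-long (<⇒≤ (≰⇒> n≰2e))

mainTheorem5 : (ℓ e : ℕ) → .{{_ : NonZero e}} → 1 ≤ ℓ →
    Σ (Circuit ℓ (e + (e + 1))) λ C →
      (count3 (gates C) ≡ 2 * ℓ + 2 * e) ×
      (count2 (gates C) ≡ 4 * e + 2 * (ℓ ∸ ℓ % e)) ×
      ((x : Vec Bool ℓ) →
        ((+ (2 ^ e ∸ 1)) ∣ (+ val (take e (run C x)) - + val x)) ×
        (val (drop e (run C x)) ≡ val x % suc (2 ^ e)))
mainTheorem5 (suc k) (suc e′) _ = residueCircuit withinBudget
  where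
  open Build {suc k} zero
  open Residues e′
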